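{- Let $G$ be the $\ell\times m$ grid graph. Then the maximum number of pairwise disjoint strong regions in $G$ is exactly one.
   Context: For an undirected graph $G=(V,E)$ and $S\subseteq V$, $\mathcal{P}_S$ is obtained by (Rule 1) putting every node of $S$ and every neighbor of a node of $S$ into $\mathcal{P}_S$, and (Rule 2) repeatedly: if $v\in\mathcal{P}_S$ and all neighbors of $v$ except exactly one neighbor $w$ are in $\mathcal{P}_S$, insert $w$. For $R\subseteq V$, $nbr(R)=\{v\in V\setminus R: v$ adjacent to some $u\in R\}$. $R$ is a strong region (i.e. an $\emptyset$-strong region) if $R\not\subseteq\mathcal{P}_{nbr(R)}$. -}

module Defs where

open import Data.Nat using (ℕ; suc)
open import Data.Fin using (Fin; toℕ)
open import Data.Bool using (Bool; true; false)
open import Data.Product using (Σ; ∃; _×_; _,_)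
open import Data.Sum using (_⊎_)
open import Data.Empty using (⊥)
open import Relation.Nullary using (¬_)
open import Relation.Binary.PropositionalEquality using (_≡_)


GridV : ℕ → ℕ → Set
GridV ℓ m = Fin ℓ × Fin m

Adj1 : ℕ → ℕ → Set
Adj1 a b = (suc a ≡ b) ⊎ (suc b ≡ a)

GridAdj : ∀ {ℓ m} → GridV ℓ m → GridV ℓ m → Set
GridAdj (i , j) (i' , j') =
  ((i ≡ i') × Adj1 (toℕ j) (toℕ j')) ⊎ ((j ≡ j') × Adj1 (toℕ i) (toℕ i'))

VSet : Set → Set
VSet V = V → Bool

_∈_ : {V : Set} → V → VSet V → Set
v ∈ S = S v ≡ true

_⊆_ : {V : Set} → VSet V → VSet V → Set
R ⊆ T = ∀ v → v ∈ R → v ∈ T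

module _ {V : Set} (Adj : V → V → Set) where

  data InP (S : V → Set) : V → Set where
    rule1-self : ∀ {v} → S v → InP S v
    rule1-nbr  : ∀ {u v} → S u → Adj u v → InP S v
    rule2      : ∀ {v w} → InP S v → Adj v w →
                 (∀ u → Adj v u → ¬ (u ≡ w) → InP S u) → InP S w

  nbr : VSet V → V → Set
  nbr R v = (R v ≡ false) × ∃ λ u → (u ∈ R) × Adj u v

  IsStrong : VSet V → Set
  IsStrong R = ¬ (∀ v → v ∈ R → InP (nbr R) v)

Disjoint : {V : Set} → VSet V → VSet V → Set
Disjoint R T = ∀ v → v ∈ R → v ∈ T → ⊥

-- For a strong region R, the vertices of R outside 𝒫_{nbr R} form a nonempty fort in the
-- sense of zero forcing: no vertex outside it has exactly one neighbour in it.  The forts of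
-- two disjoint strong regions are moreover disjoint and non-adjacent.  In a grid the first
-- row forces everything, so every fort meets it.  Taking there a vertex of each fort with
-- neither fort strictly in between, the fort condition pushes the left one diagonally
-- down-right and the right one down-left, row by row, until they touch or coincide.  The
-- whole vertex set is strong because 𝒫_∅ = ∅.
module Submission where

open import Defs
open import Data.Nat using (ℕ; _≥_; zero; suc; _+_; _∸_; _≤_; _<_; s≤s)
open import Data.Nat.Properties
open import Data.Nat.Induction using (<-rec)
open import Data.Fin using (Fin; toℕ; fromℕ<)
import Data.Fin as Fin
open import Data.Fin.Properties using (toℕ-injective; toℕ<n; toℕ-fromℕ<)
open import Data.Bool using (true; false)
open import Data.Bool.Properties using (¬-not)
open import Data.Product using (Σ; ∃; ∃₂; _×_; _,_; proj₁; proj₂)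
open import Data.Sum using (_⊎_; inj₁; inj₂)
open import Data.Empty using (⊥; ⊥-elim)
open import Function using (_∘_; flip)
open import Relation.Nullary using (¬_)
open import Relation.Binary.Definitions using (Symmetric)
open import Relation.Binary.PropositionalEquality using (_≡_; refl; sym; cong; cong₂; subst)

-- Membership in 𝒫_S is not decidable, so the arguments run under double negation; finiteness
-- of the vertex set provides this shift.
DoubleNegationShift : Set → Set₁
DoubleNegationShift V = ∀ {P : V → Set} → (∀ v → ¬ ¬ P v) → ¬ ¬ (∀ v → P v)

Fin-¬¬-shift : ∀ n → DoubleNegationShift (Fin n)
Fin-¬¬-shift zero    _ ¬all = ¬all λ ()
Fin-¬¬-shift (suc n) h ¬all =
  h Fin.zero λ p₀ → Fin-¬¬-shift n (h ∘ Fin.suc) λ ps →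
    ¬all λ { Fin.zero → p₀ ; (Fin.suc i) → ps i }

×-¬¬-shift : ∀ {A B} → DoubleNegationShift A → DoubleNegationShift B →
             DoubleNegationShift (A × B)
×-¬¬-shift shiftA shiftB h ¬all =
  shiftA (λ a → shiftB (λ b → h (a , b))) λ f → ¬all λ (a , b) → f a b

¬¬-→₂ : {A B C : Set} → (A → B → ¬ ¬ C) → ¬ ¬ (A → B → C)
¬¬-→₂ f ¬g = ¬g λ a b → ⊥-elim (f a b λ c → ¬g λ _ _ → c)

module _ {V : Set} (Adj : V → V → Set) where

  IsFort : (V → Set) → Set
  IsFort F = ∀ {w u} → Adj w u → F u → ¬ F w → (∀ x → Adj w x → F x → x ≡ u) → ⊥

  Unforced : VSet V → V → Set
  Unforced R v = v ∈ R × ¬ InP Adj (nbr Adj R) v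

  InP-∅ : ∀ {S v} → (∀ u → ¬ S u) → ¬ InP Adj S v
  InP-∅ S-empty (rule1-self s)  = S-empty _ s
  InP-∅ S-empty (rule1-nbr s _) = S-empty _ s
  InP-∅ S-empty (rule2 p _ _)   = InP-∅ S-empty p

  strong⇒¬¬unforced : DoubleNegationShift V → ∀ {R} → IsStrong Adj R → ¬ ¬ ∃ (Unforced R)
  strong⇒¬¬unforced shift {R} strong none = shift covered strong
    where
    covered : ∀ v → ¬ ¬ (v ∈ R → InP Adj (nbr Adj R) v)
    covered v ¬covered = ¬covered λ v∈R → ⊥-elim (none (v , v∈R , λ p → ¬covered λ _ → p))

  module _ (adj-sym : Symmetric Adj) where

    unforced-separated : ∀ {R₁ R₂ u v} → Disjoint R₁ R₂ →
                         Unforced R₁ u → Unforced R₂ v → ¬ Adj u v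
    unforced-separated {R₁} {v = v} disjoint (u∈R₁ , u∉𝒫) (v∈R₂ , _) u~v =
      u∉𝒫 (rule1-nbr (v∉R₁ , _ , u∈R₁ , u~v) (adj-sym u~v))
      where
      v∉R₁ : R₁ v ≡ false
      v∉R₁ = ¬-not λ v∈R₁ → disjoint v v∈R₁ v∈R₂

    unforced-isFort : DoubleNegationShift V → ∀ R → IsFort (Unforced R)
    unforced-isFort shift R {w} {u} w~u (u∈R , u∉𝒫) w∉F sole with R w in w∈?R
    ... | false = u∉𝒫 (rule1-nbr (w∈?R , u , u∈R , adj-sym w~u) w~u)
    ... | true  = w∉F (refl , λ w∈𝒫 →
                    shift (λ x → ¬¬-→₂ (others x)) λ all → u∉𝒫 (rule2 w∈𝒫 w~u all))
      where
      others : ∀ x → Adj w x → ¬ x ≡ u → ¬ ¬ InP Adj (nbr Adj R) x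
      others x w~x x≢u x∉𝒫 with R x in x∈?R
      ... | true  = x≢u (sole x w~x (x∈?R , x∉𝒫))
      ... | false = x∉𝒫 (rule1-self (x∈?R , w , w∈?R , w~x))

Adj1-sym : ∀ {a b} → Adj1 a b → Adj1 b a
Adj1-sym (inj₁ e) = inj₂ e
Adj1-sym (inj₂ e) = inj₁ e

GridAdjℕ : ℕ → ℕ → ℕ → ℕ → Set
GridAdjℕ a b i j = (a ≡ i × Adj1 b j) ⊎ (b ≡ j × Adj1 a i)

GridAdjℕ-sym : ∀ {a b i j} → GridAdjℕ a b i j → GridAdjℕ i j a b
GridAdjℕ-sym (inj₁ (e , a~i)) = inj₁ (sym e , Adj1-sym a~i)
GridAdjℕ-sym (inj₂ (e , b~j)) = inj₂ (sym e , Adj1-sym b~j)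

NotLeft NotAbove : (ℕ → ℕ → Set) → ℕ → ℕ → Set
NotLeft  P a b = ∀ {b'} → suc b' ≡ b → ¬ P a b'
NotAbove P a b = ∀ {a'} → suc a' ≡ a → ¬ P a' b

record GridFort (ℓ m : ℕ) (P : ℕ → ℕ → Set) : Set where
  field
    bounded : ∀ {i j} → P i j → i < ℓ × j < m
    no-sole-neighbour : ∀ {a b i j} → a < ℓ → b < m → GridAdjℕ a b i j → P i j → ¬ P a b →
                        (∀ i' j' → GridAdjℕ a b i' j' → P i' j' → i' ≡ i × j' ≡ j) → ⊥

module GridFortProperties {ℓ m P} (fort : GridFort ℓ m P) where
  open GridFort fort

  below-empty : ∀ {a b} → ¬ P a b → ¬ P a (suc b) → NotLeft P a b → NotAbove P a b →
                ¬ P (suc a) b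
  below-empty {a} {b} ¬ab ¬right ¬left ¬above below =
    no-sole-neighbour (<-trans (n<1+n a) (proj₁ (bounded below))) (proj₂ (bounded below))
      (inj₂ (refl , inj₁ refl)) below ¬ab sole
    where
    sole : ∀ i' j' → GridAdjℕ a b i' j' → P i' j' → i' ≡ suc a × j' ≡ b
    sole _ _ (inj₁ (refl , inj₁ refl)) p = ⊥-elim (¬right p)
    sole _ _ (inj₁ (refl , inj₂ e))    p = ⊥-elim (¬left e p)
    sole _ _ (inj₂ (refl , inj₁ refl)) _ = refl , refl
    sole _ _ (inj₂ (refl , inj₂ e))    p = ⊥-elim (¬above e p)

  ¬¬-down-right : ∀ {a b} → suc b < m → P a b → ¬ P a (suc b) → ¬ P a (suc (suc b)) →
                  NotAbove P a (suc b) → ¬ ¬ P (suc a) (suc b)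
  ¬¬-down-right {a} {b} b+1<m ab ¬w ¬right ¬above ¬below =
    no-sole-neighbour (proj₁ (bounded ab)) b+1<m (inj₁ (refl , inj₂ refl)) ab ¬w sole
    where
    sole : ∀ i' j' → GridAdjℕ a (suc b) i' j' → P i' j' → i' ≡ a × j' ≡ b
    sole _ _ (inj₁ (refl , inj₁ refl)) p = ⊥-elim (¬right p)
    sole _ _ (inj₁ (refl , inj₂ refl)) _ = refl , refl
    sole _ _ (inj₂ (refl , inj₁ refl)) p = ⊥-elim (¬below p)
    sole _ _ (inj₂ (refl , inj₂ e))    p = ⊥-elim (¬above e p)

  ¬¬-down-left : ∀ {a b} → P a (suc b) → ¬ P a b → NotLeft P a b → NotAbove P a b →
                 ¬ ¬ P (suc a) b
  ¬¬-down-left {a} {b} right ¬w ¬left ¬above ¬below =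
    no-sole-neighbour (proj₁ (bounded right)) (<-trans (n<1+n b) (proj₂ (bounded right)))
      (inj₁ (refl , inj₁ refl)) right ¬w sole
    where
    sole : ∀ i' j' → GridAdjℕ a b i' j' → P i' j' → i' ≡ a × j' ≡ suc b
    sole _ _ (inj₁ (refl , inj₁ refl)) _ = refl , refl
    sole _ _ (inj₁ (refl , inj₂ e))    p = ⊥-elim (¬left e p)
    sole _ _ (inj₂ (refl , inj₁ refl)) p = ⊥-elim (¬below p)
    sole _ _ (inj₂ (refl , inj₂ e))    p = ⊥-elim (¬above e p)

  EmptyRow : ℕ → Set
  EmptyRow i = ∀ j → ¬ P i j

  meets-row₀ : ∀ {i j} → P i j → ¬ EmptyRow 0
  meets-row₀ {i} {j} p row₀ = proj₁ (rows i) j p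
    where
    next : ∀ {i} → (∀ {i'} → suc i' ≡ i → EmptyRow i') → EmptyRow i → EmptyRow (suc i)
    next above row j = below-empty (row j) (row (suc j)) (λ _ → row _) (λ e → above e j)
    rows : ∀ i → EmptyRow i × EmptyRow (suc i)
    rows zero    = row₀ , next (λ ()) row₀
    rows (suc i) = proj₂ (rows i) , next (λ { refl → proj₁ (rows i) }) (proj₂ (rows i))

module SeparatedGridForts {ℓ m A B} (A-fort : GridFort ℓ m A) (B-fort : GridFort ℓ m B)
  (disjoint : ∀ {i j} → A i j → ¬ B i j)
  (separated : ∀ {a b i j} → A a b → B i j → ¬ GridAdjℕ a b i j) where
  module FA = GridFortProperties A-fort
  module FB = GridFortProperties B-fort

  record Gap (r p q : ℕ) : Set where
    field
      A-at    : A r p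
      B-at    : B r q
      A-only  : ∀ {k} → p < k → k ≤ q → ¬ A r k
      B-only  : ∀ {k} → p ≤ k → k < q → ¬ B r k
      A-above : ∀ {k} → p < k → k < q → NotAbove A r k
      B-above : ∀ {k} → p < k → k < q → NotAbove B r k

  gap-descends : ∀ {r p q} → p ≤ q → Gap r p (suc (suc q)) → ¬ ¬ Gap (suc r) (suc p) (suc q)
  gap-descends {r} {p} {q} p≤q gap ¬gap =
    FA.¬¬-down-right p+1<m A-at
      (A-only (n<1+n p) (m≤n⇒m≤1+n (s≤s p≤q)))
      (A-only (n≤1+n (suc p)) (s≤s (s≤s p≤q)))
      (A-above (n<1+n p) (s≤s (s≤s p≤q))) λ A-at′ →
    FB.¬¬-down-left B-at
      (B-only (m≤n⇒m≤1+n p≤q) (n<1+n (suc q)))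
      (λ { refl → B-only p≤q (m<n⇒m<1+n (n<1+n q)) })
      (B-above (s≤s p≤q) (n<1+n (suc q))) λ B-at′ →
    ¬gap record
      { A-at = A-at′ ; B-at = B-at′ ; A-only = A-only′ ; B-only = B-only′
      ; A-above = λ p+1<k k<q+1 → λ { refl →
          A-only (<-trans (n<1+n p) p+1<k) (m≤n⇒m≤1+n (<⇒≤ k<q+1)) }
      ; B-above = λ p+1<k k<q+1 → λ { refl →
          B-only (<⇒≤ (<-trans (n<1+n p) p+1<k)) (m<n⇒m<1+n k<q+1) }
      }
    where
    open Gap gap
    p+1<m : suc p < m
    p+1<m = ≤-<-trans (s≤s p≤q) (<-trans (n<1+n (suc q)) (proj₂ (GridFort.bounded B-fort B-at)))
    A-only′ : ∀ {k} → suc p < k → k ≤ suc q → ¬ A (suc r) k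
    A-only′ {suc (suc k)} (s≤s (s≤s p≤k)) k+2≤q+1 =
      FA.below-empty (A-only (s≤s (m≤n⇒m≤1+n p≤k)) (m≤n⇒m≤1+n k+2≤q+1))
                     (A-only (s≤s (m≤n⇒m≤1+n (m≤n⇒m≤1+n p≤k))) (s≤s k+2≤q+1))
                     (λ { refl → A-only (s≤s p≤k) (<⇒≤ (m<n⇒m<1+n k+2≤q+1)) })
                     (A-above (s≤s (m≤n⇒m≤1+n p≤k)) (s≤s k+2≤q+1))
    B-only′ : ∀ {k} → suc p ≤ k → k < suc q → ¬ B (suc r) k
    B-only′ {suc k} (s≤s p≤k) k+1<q+1 =
      FB.below-empty (B-only (m≤n⇒m≤1+n p≤k) (m<n⇒m<1+n k+1<q+1))
                     (B-only (m≤n⇒m≤1+n (m≤n⇒m≤1+n p≤k)) (s≤s k+1<q+1))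
                     (λ { refl → B-only p≤k (<-trans (n<1+n k) (m<n⇒m<1+n k+1<q+1)) })
                     (B-above (s≤s p≤k) (m<n⇒m<1+n k+1<q+1))

  gap-closes : ∀ d {r p} → Gap r p (d + p) → ⊥
  gap-closes zero          gap = disjoint (Gap.A-at gap) (Gap.B-at gap)
  gap-closes (suc zero)    gap = separated (Gap.A-at gap) (Gap.B-at gap) (inj₁ (refl , inj₁ refl))
  gap-closes (suc (suc d)) {p = p} gap =
    gap-descends (m≤n+m p d) gap λ gap′ →
      gap-closes d (subst (Gap _ (suc p)) (sym (+-suc d p)) gap′)

  -- Choose the A-point and the B-point in the first row as close as possible.
  row₀-closes : ∀ {p q} → p ≤ q → A 0 p → B 0 q → ⊥
  row₀-closes {p} {q} = <-rec Closes closes (q ∸ p) refl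
    where
    Closes : ℕ → Set
    Closes w = ∀ {p q} → q ∸ p ≡ w → p ≤ q → A 0 p → B 0 q → ⊥
    closes : ∀ w → (∀ {v} → v < w → Closes v) → Closes w
    closes _ rec {p} {q} refl p≤q a b =
      gap-closes (q ∸ p) (subst (Gap 0 p) (sym (m∸n+n≡m p≤q)) record
        { A-at = a ; B-at = b
        ; A-only = λ p<k k≤q a′ → rec (∸-monoʳ-< p<k k≤q) refl k≤q a′ b
        ; B-only = λ p≤k k<q b′ → rec (∸-monoˡ-< k<q p≤k) refl p≤k a b′
        ; A-above = λ _ _ ()
        ; B-above = λ _ _ ()
        })

no-separated-gridForts : ∀ {ℓ m A B} → GridFort ℓ m A → GridFort ℓ m B →
  (∀ {i j} → A i j → ¬ B i j) → (∀ {a b i j} → A a b → B i j → ¬ GridAdjℕ a b i j) →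
  ∀ {a b i j} → A a b → ¬ B i j
no-separated-gridForts {A = A} {B = B} A-fort B-fort disjoint separated a b =
  meets-row₀ A-fort a λ p a₀ → meets-row₀ B-fort b λ q b₀ → closes p q a₀ b₀
  where
  open GridFortProperties using (meets-row₀)
  closes : ∀ p q → A 0 p → B 0 q → ⊥
  closes p q a₀ b₀ with ≤-total p q
  ... | inj₁ p≤q = SeparatedGridForts.row₀-closes A-fort B-fort disjoint separated p≤q a₀ b₀
  ... | inj₂ q≤p = SeparatedGridForts.row₀-closes B-fort A-fort (flip disjoint)
                     (λ b a → separated a b ∘ GridAdjℕ-sym) q≤p b₀ a₀

GridAdj-sym : ∀ {ℓ m} → Symmetric (GridAdj {ℓ} {m})
GridAdj-sym (inj₁ (e , j~j')) = inj₁ (sym e , Adj1-sym j~j')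
GridAdj-sym (inj₂ (e , i~i')) = inj₂ (sym e , Adj1-sym i~i')

GridV-¬¬-shift : ∀ ℓ m → DoubleNegationShift (GridV ℓ m)
GridV-¬¬-shift ℓ m = ×-¬¬-shift (Fin-¬¬-shift ℓ) (Fin-¬¬-shift m)

module _ {ℓ m : ℕ} where

  GridAdj⇒GridAdjℕ : ∀ {i i' : Fin ℓ} {j j' : Fin m} → GridAdj (i , j) (i' , j') →
                     GridAdjℕ (toℕ i) (toℕ j) (toℕ i') (toℕ j')
  GridAdj⇒GridAdjℕ (inj₁ (e , j~j')) = inj₁ (cong toℕ e , j~j')
  GridAdj⇒GridAdjℕ (inj₂ (e , i~i')) = inj₂ (cong toℕ e , i~i')

  GridAdjℕ⇒GridAdj : ∀ {i i' : Fin ℓ} {j j' : Fin m} →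
                     GridAdjℕ (toℕ i) (toℕ j) (toℕ i') (toℕ j') → GridAdj (i , j) (i' , j')
  GridAdjℕ⇒GridAdj (inj₁ (e , j~j')) = inj₁ (toℕ-injective e , j~j')
  GridAdjℕ⇒GridAdj (inj₂ (e , i~i')) = inj₂ (toℕ-injective e , i~i')

  Lift : (GridV ℓ m → Set) → ℕ → ℕ → Set
  Lift F i j = ∃₂ λ a b → toℕ a ≡ i × toℕ b ≡ j × F (a , b)

  lift-gridFort : ∀ {F} → IsFort GridAdj F → GridFort ℓ m (Lift F)
  lift-gridFort {F} fort = record
    { bounded = λ { (a , b , refl , refl , _) → toℕ<n a , toℕ<n b }
    ; no-sole-neighbour = no-sole-neighbour
    }
    where
    no-sole-neighbour-at : ∀ (a : Fin ℓ) (b : Fin m) {i j} → GridAdjℕ (toℕ a) (toℕ b) i j →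
      Lift F i j → ¬ Lift F (toℕ a) (toℕ b) →
      (∀ i' j' → GridAdjℕ (toℕ a) (toℕ b) i' j' → Lift F i' j' → i' ≡ i × j' ≡ j) → ⊥
    no-sole-neighbour-at a b w~u (u₁ , u₂ , refl , refl , Fu) ¬Lw sole =
      fort (GridAdjℕ⇒GridAdj w~u) Fu (λ Fw → ¬Lw (a , b , refl , refl , Fw)) unique
      where
      unique : ∀ x → GridAdj (a , b) x → F x → x ≡ (u₁ , u₂)
      unique (x₁ , x₂) w~x Fx with sole _ _ (GridAdj⇒GridAdjℕ w~x) (x₁ , x₂ , refl , refl , Fx)
      ... | e₁ , e₂ = cong₂ _,_ (toℕ-injective e₁) (toℕ-injective e₂)
    no-sole-neighbour : ∀ {a b i j} → a < ℓ → b < m → GridAdjℕ a b i j → Lift F i j → ¬ Lift F a b →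
                        (∀ i' j' → GridAdjℕ a b i' j' → Lift F i' j' → i' ≡ i × j' ≡ j) → ⊥
    no-sole-neighbour a<ℓ b<m
      with fromℕ< a<ℓ | toℕ-fromℕ< a<ℓ | fromℕ< b<m | toℕ-fromℕ< b<m
    ... | a | refl | b | refl = no-sole-neighbour-at a b

  no-separated-forts : ∀ {F G : GridV ℓ m → Set} → IsFort GridAdj F → IsFort GridAdj G →
    (∀ {v} → F v → ¬ G v) → (∀ {u v} → F u → G v → ¬ GridAdj u v) → ∀ {u v} → F u → ¬ G v
  no-separated-forts {F} {G} F-fort G-fort disjoint separated {a , b} {i , j} Fu Gv =
    no-separated-gridForts (lift-gridFort F-fort) (lift-gridFort G-fort)
      lifted-disjoint lifted-separated (a , b , refl , refl , Fu) (i , j , refl , refl , Gv)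
    where
    lifted-disjoint : ∀ {i j} → Lift F i j → ¬ Lift G i j
    lifted-disjoint (_ , _ , refl , refl , Fv) (_ , _ , e₁ , e₂ , Gv)
      with toℕ-injective e₁ | toℕ-injective e₂
    ... | refl | refl = disjoint Fv Gv
    lifted-separated : ∀ {a b i j} → Lift F a b → Lift G i j → ¬ GridAdjℕ a b i j
    lifted-separated (_ , _ , refl , refl , Fu) (_ , _ , refl , refl , Gv) =
      separated Fu Gv ∘ GridAdjℕ⇒GridAdj

lemma6 : (ℓ m : ℕ) → ℓ ≥ 1 → m ≥ 1 →
    Σ (VSet (GridV ℓ m)) (IsStrong GridAdj)
    × (∀ (R₁ R₂ : VSet (GridV ℓ m)) → IsStrong GridAdj R₁ → IsStrong GridAdj R₂ → ¬ Disjoint R₁ R₂)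
lemma6 ℓ m ℓ≥1 m≥1 = (whole , whole-strong) , no-disjoint
  where
  whole : VSet (GridV ℓ m)
  whole _ = true
  whole-strong : IsStrong GridAdj whole
  whole-strong covered =
    InP-∅ GridAdj (λ { _ (() , _) }) (covered (fromℕ< ℓ≥1 , fromℕ< m≥1) refl)
  no-disjoint : ∀ R₁ R₂ → IsStrong GridAdj R₁ → IsStrong GridAdj R₂ → ¬ Disjoint R₁ R₂
  no-disjoint R₁ R₂ strong₁ strong₂ disjoint =
    strong⇒¬¬unforced GridAdj shift strong₁ λ (u , u-unforced) →
    strong⇒¬¬unforced GridAdj shift strong₂ λ (v , v-unforced) →
    no-separated-forts (unforced-isFort GridAdj GridAdj-sym shift R₁)
                       (unforced-isFort GridAdj GridAdj-sym shift R₂)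
                       (λ (x∈R₁ , _) (x∈R₂ , _) → disjoint _ x∈R₁ x∈R₂)
                       (unforced-separated GridAdj GridAdj-sym disjoint)
                       u-unforced v-unforced
    where
    shift : DoubleNegationShift (GridV ℓ m)
    shift = GridV-¬¬-shift ℓ m
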